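{- Let $m$ be any extrapolator. The set of sequences weakly NV-learnable by $m$ is a meagre subset of $\mathcal{C}$.
   Context: $\mathcal{B}^*$ is the set of finite binary strings; $\mathcal{C}$ is the set of infinite binary sequences $\sigma=\sigma(1)\sigma(2)\dots$ with the product topology (Cantor space); $\sigma[k]$ is the string of the first $k$ bits. An extrapolator is any function $m:\mathcal{B}^*\to\{0,1\}$. $m$ weakly NV-learns $\sigma$ if $\lim_{n\to\infty}\frac{|\{k\le n: m(\sigma[k])=\sigma(k+1)\}|}{n}=1$. -}

module Defs where

open import Data.Bool using (Bool; true; false; if_then_else_)
open import Data.Bool.Properties using () renaming (_≟_ to _≟ᵇ_)
open import Data.Nat using (ℕ; zero; suc; _+_; _≤_; _≥_)
open import Data.Integer using (+_)
open import Data.List using (List; map; upTo; length; _++_)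
open import Data.Product using (Σ; ∃; _×_)
open import Data.Rational using (ℚ; _/_; _-_; _<_; ∣_∣; 0ℚ; 1ℚ)
open import Relation.Binary.PropositionalEquality using (_≡_)
open import Relation.Nullary using (¬_; does)

-- Cantor space: σ : ℕ → Bool, with σ i the paper's bit σ(i+1).
Seq : Set
Seq = ℕ → Bool

Str : Set
Str = List Bool

prefix : Seq → ℕ → Str
prefix σ k = map σ (upTo k)

Extrapolator : Set
Extrapolator = Str → Bool

-- |{ k ≤ n : m(σ[k]) = σ(k+1) }| with k ranging over 1 … n
hits : Extrapolator → Seq → ℕ → ℕ
hits m σ zero    = 0
hits m σ (suc n) = hits m σ n + (if does (m (prefix σ (suc n)) ≟ᵇ σ (suc n)) then 1 else 0)

-- the ratio hits/n, for n = suc k ≥ 1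
ratio : Extrapolator → Seq → ℕ → ℚ
ratio m σ k = (+ hits m σ (suc k)) / suc k

WeaklyNVLearns : Extrapolator → Seq → Set
WeaklyNVLearns m σ =
  ∀ (ε : ℚ) → 0ℚ < ε → ∃ λ N → ∀ k → k ≥ N → ∣ ratio m σ k - 1ℚ ∣ < ε

Extends : Seq → Str → Set
Extends σ s = prefix σ (length s) ≡ s

NowhereDense : (Seq → Set) → Set
NowhereDense A = ∀ (s : Str) → ∃ λ (t : Str) → ∀ σ → Extends σ (s ++ t) → ¬ A σ

Meagre : (Seq → Set) → Set₁
Meagre A = Σ (ℕ → Seq → Set) λ N →
  (∀ i → NowhereDense (N i)) × (∀ σ → A σ → ∃ λ i → N i σ)

module Submission where

-- Against any extrapolator m, every finite string can be continued by a block
-- on which each bit is the opposite of m's prediction; a long enough such block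
-- drags the hit rate down to ½.  Hence for each i the set of sequences whose hit
-- rate stays above ½ from position i on is nowhere dense, and every sequence m
-- weakly NV-learns lies in one of these sets.

open import Defs
open import Data.Bool using (true; false; not; if_then_else_)
open import Data.Bool.Properties using () renaming (_≟_ to _≟ᵇ_)
open import Data.Nat as ℕ using (ℕ; zero; suc; _+_; _*_; _≤_; _<_; z≤n; s≤s)
open import Data.Nat.Properties as ℕ
  using (≤-trans; m≤m+n; m≤n+m; n≤1+n; m≤n⇒m≤1+n; *-monoˡ-≤; <⇒≱; ≰⇒>; m<1+n⇒m<n∨m≡n)
open import Data.Integer as ℤ using (+_; +≤+)
import Data.Integer.Properties as ℤ
open import Data.List using ([]; [_]; _∷ʳ_; map; upTo; length; _++_)
open import Data.List.Properties using (map-++; upTo-∷ʳ; ++-assoc; length-++; ∷ʳ-injective)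
open import Data.Product using (∃; _×_; _,_)
open import Data.Rational as ℚ using (1ℚ; ½; ∣_∣; -_; _-_)
import Data.Rational.Properties as ℚ
import Data.Rational.Unnormalised as ℚᵘ
import Data.Rational.Unnormalised.Properties as ℚᵘ
open import Data.Sum using (inj₁; inj₂)
open import Relation.Binary.PropositionalEquality
  using (_≡_; refl; sym; trans; cong; subst; subst₂; module ≡-Reasoning)
open import Relation.Nullary using (does)

-p≤∣p∣ : ∀ p → - p ℚ.≤ ∣ p ∣
-p≤∣p∣ p with ℚ.∣p∣≡p∨∣p∣≡-p p
... | inj₁ ∣p∣≡p  = ℚ.≤-trans (ℚ.neg-antimono-≤ (ℚ.∣p∣≡p⇒0≤p ∣p∣≡p)) (ℚ.0≤∣p∣ p)
... | inj₂ ∣p∣≡-p = ℚ.≤-reflexive (sym ∣p∣≡-p)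

½≤∣q-1∣ : ∀ {q} → q ℚ.≤ ½ → ½ ℚ.≤ ∣ q - 1ℚ ∣
½≤∣q-1∣ {q} q≤½ = begin
  ½              ≤⟨ ℚ.+-monoʳ-≤ 1ℚ (ℚ.neg-antimono-≤ q≤½) ⟩
  1ℚ - q         ≡⟨ ℚ.+-comm 1ℚ (- q) ⟩
  - q ℚ.+ - - 1ℚ ≡⟨ ℚ.neg-distrib-+ q (- 1ℚ) ⟨
  - (q - 1ℚ)     ≤⟨ -p≤∣p∣ (q - 1ℚ) ⟩
  ∣ q - 1ℚ ∣     ∎
  where open ℚ.≤-Reasoning

h/1+k≤½ : ∀ h k → h * 2 ≤ suc k → (+ h) ℚ./ suc k ℚ.≤ ½
h/1+k≤½ h k h*2≤1+k = ℚ.toℚᵘ-cancel-≤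
  (ℚᵘ.≤-respˡ-≃ (ℚᵘ.≃-sym (ℚ.toℚᵘ-fromℚᵘ (ℚᵘ.mkℚᵘ (+ h) k)))
    (ℚᵘ.*≤* (subst₂ ℤ._≤_ (ℤ.pos-* h 2) (sym (ℤ.*-identityˡ (+ suc k))) (+≤+ h*2≤1+k))))

prefix-suc : ∀ σ n → prefix σ (suc n) ≡ prefix σ n ∷ʳ σ n
prefix-suc σ n = trans (cong (map σ) (sym (upTo-∷ʳ n))) (map-++ σ (upTo n) [ n ])

prefix-suc⁻¹ : ∀ {σ n w b} → prefix σ (suc n) ≡ w ∷ʳ b → prefix σ n ≡ w × σ n ≡ b
prefix-suc⁻¹ {σ} {n} {w} eq = ∷ʳ-injective (prefix σ n) w (trans (sym (prefix-suc σ n)) eq)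

module _ (m : Extrapolator) where

  Misses : Seq → ℕ → Set
  Misses σ j = σ j ≡ not (m (prefix σ j))

  hits-≤ : ∀ σ n → hits m σ n ≤ n
  hits-≤ σ zero    = z≤n
  hits-≤ σ (suc n) with does (m (prefix σ (suc n)) ≟ᵇ σ (suc n))
  ... | true  = subst (_≤ suc n) (ℕ.+-comm 1 (hits m σ n)) (s≤s (hits-≤ σ n))
  ... | false = subst (_≤ suc n) (sym (ℕ.+-identityʳ (hits m σ n))) (m≤n⇒m≤1+n (hits-≤ σ n))

  hits-stalls : ∀ σ L d → (∀ i → i < d → Misses σ (suc (i + L))) → hits m σ (d + L) ≡ hits m σ L
  hits-stalls σ L zero    misses = refl
  hits-stalls σ L (suc d) misses = begin
    hits m σ (d + L) + (if does (m w ≟ᵇ σ (suc (d + L))) then 1 else 0)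
      ≡⟨ cong (λ b → hits m σ (d + L) + (if does (m w ≟ᵇ b) then 1 else 0)) (misses d ℕ.≤-refl) ⟩
    hits m σ (d + L) + (if does (m w ≟ᵇ not (m w)) then 1 else 0)
      ≡⟨ cong (λ x → hits m σ (d + L) + x) (b≠¬b (m w)) ⟩
    hits m σ (d + L) + 0
      ≡⟨ ℕ.+-identityʳ _ ⟩
    hits m σ (d + L)
      ≡⟨ hits-stalls σ L d (λ i i<d → misses i (m≤n⇒m≤1+n i<d)) ⟩
    hits m σ L ∎
    where
    open ≡-Reasoning
    w = prefix σ (suc (d + L))
    b≠¬b : ∀ b → (if does (b ≟ᵇ not b) then 1 else 0) ≡ 0
    b≠¬b false = refl
    b≠¬b true  = refl

  defeat : Str → ℕ → Str
  defeat s zero    = []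
  defeat s (suc r) = defeat s r ∷ʳ not (m (s ++ defeat s r))

  length-defeat : ∀ s r → length (defeat s r) ≡ r
  length-defeat s zero    = refl
  length-defeat s (suc r) = trans (length-++ (defeat s r)) (trans (ℕ.+-comm _ 1) (cong suc (length-defeat s r)))

  length-++-defeat : ∀ s r → length (s ++ defeat s r) ≡ r + length s
  length-++-defeat s r = begin
    length (s ++ defeat s r)       ≡⟨ length-++ s ⟩
    length s + length (defeat s r) ≡⟨ ℕ.+-comm (length s) _ ⟩
    length (defeat s r) + length s ≡⟨ cong (_+ length s) (length-defeat s r) ⟩
    r + length s                   ∎
    where open ≡-Reasoning

  defeat-misses : ∀ s r σ → prefix σ (r + length s) ≡ s ++ defeat s r →
                  ∀ i → i < r → Misses σ (i + length s)
  defeat-misses s (suc r) σ ext i i<1+r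
    with prefix-suc⁻¹ (trans ext (sym (++-assoc s (defeat s r) _)))
  ... | ext′ , last with m<1+n⇒m<n∨m≡n i<1+r
  ... | inj₁ i<r  = defeat-misses s r σ ext′ i i<r
  ... | inj₂ refl = trans last (cong (λ w → not (m w)) (sym ext′))

  MajorityHitsFrom : ℕ → Seq → Set
  MajorityHitsFrom i σ = ∀ k → i ≤ k → suc k < hits m σ (suc k) * 2

  majorityHitsFrom-nowhereDense : ∀ i → NowhereDense (MajorityHitsFrom i)
  majorityHitsFrom-nowhereDense i s =
    defeat s r , λ σ ext majority → <⇒≱ (majority k (≤-trans (m≤m+n i _) (m≤m+n _ L))) (hits*2≤ σ ext)
    where
    L = length s
    d = suc (i + L * 2)
    k = i + L * 2 + L
    r = suc d
    -- Every position past s up to suc k is a miss, so at most L of the suc k ≥ 2 L are hits.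
    hits*2≤ : ∀ σ → Extends σ (s ++ defeat s r) → hits m σ (suc k) * 2 ≤ suc k
    hits*2≤ σ ext = begin
      hits m σ (suc k) * 2 ≡⟨ cong (_* 2) (hits-stalls σ L d misses) ⟩
      hits m σ L * 2       ≤⟨ *-monoˡ-≤ 2 (hits-≤ σ L) ⟩
      L * 2                ≤⟨ m≤n+m _ i ⟩
      i + L * 2            ≤⟨ m≤m+n _ L ⟩
      k                    ≤⟨ n≤1+n k ⟩
      suc k                ∎
      where
      open ℕ.≤-Reasoning
      ext′ : prefix σ (r + L) ≡ s ++ defeat s r
      ext′ = trans (cong (prefix σ) (sym (length-++-defeat s r))) ext
      misses : ∀ j → j < d → Misses σ (suc (j + L))
      misses j j<d = defeat-misses s r σ ext′ (suc j) (s≤s j<d)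

  learns⇒majorityHits : ∀ σ → WeaklyNVLearns m σ → ∃ λ i → MajorityHitsFrom i σ
  learns⇒majorityHits σ learns with learns ½ (ℚ.positive⁻¹ ½)
  ... | N , close = N , λ k N≤k → ≰⇒> λ hits*2≤ →
    ℚ.<-irrefl refl (ℚ.≤-<-trans (½≤∣q-1∣ (h/1+k≤½ (hits m σ (suc k)) k hits*2≤)) (close k N≤k))

proposition6 : (m : Extrapolator) → Meagre (WeaklyNVLearns m)
proposition6 m = MajorityHitsFrom m , majorityHitsFrom-nowhereDense m , learns⇒majorityHits m
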